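{- For every integer $0\le a\le b-1$ we have $N_{a,A}\leq b-1$. Moreover, if $A=\{ 0,1,b\}$ then $N_{b-1,A}=b-1$.
   Context: $A$ is a finite set of integers with smallest element $0$, largest element $b\ge1$, and gcd of its elements equal to $1$. $\mathbb N=\{0,1,2,\dots\}$. For an integer $N\ge1$, $NA=\{a_1+\cdots+a_N:a_i\in A\}$ (repetitions allowed), and $0A=\{0\}$. $\mathcal P(A)=\{\sum_{x\in A} n_x x: n_x\in\mathbb N\}$. For an integer $c$, $n_{c,A}=\min\{n\ge 0: n\equiv c\pmod b,\ n\in\mathcal P(A)\}$ and $N_{c,A}=\min\{N\ge0: n_{c,A}\in NA\}$. -}

module Defs where

open import Data.Nat using (ℕ; zero; suc; _+_; _*_; _∸_; _≤_; _<_)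
open import Data.Nat.GCD using (gcd)
open import Data.List using (List; []; _∷_; length; foldr)
open import Data.Nat.ListAction using (sum)
open import Data.List.Relation.Unary.All using (All)
open import Data.List.Membership.Propositional using (_∈_)
open import Data.Product using (Σ; ∃; _×_)
open import Relation.Binary.PropositionalEquality using (_≡_)

-- A finite set of (nonnegative) integers, given as a list of its elements.
-- gcd of the elements of A (gcd of the empty list is 0).
gcdList : List ℕ → ℕ
gcdList = foldr gcd 0

record Admissible (A : List ℕ) (b : ℕ) : Set where
  field
    zero∈A  : 0 ∈ A
    b∈A     : b ∈ A
    A≤b     : All (_≤ b) A
    b≥1     : 1 ≤ b
    gcd≡1   : gcdList A ≡ 1

ModEq : ℕ → ℕ → ℕ → Set
ModEq b m n = ∃ λ k → ∃ λ l → m + k * b ≡ n + l * b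

InSumset : List ℕ → ℕ → ℕ → Set
InSumset A N n = Σ (List ℕ) λ xs → length xs ≡ N × All (_∈ A) xs × sum xs ≡ n

InP : List ℕ → ℕ → Set
InP A n = ∃ λ N → InSumset A N n

IsNc : List ℕ → ℕ → ℕ → ℕ → Set
IsNc A b c n = ModEq b n c × InP A n × (∀ m → ModEq b m c → InP A m → n ≤ m)

IsNN : List ℕ → ℕ → ℕ → Set
IsNN A n N = InSumset A N n × (∀ M → InSumset A M n → N ≤ M)

-- Every residue class modulo b meets 𝒫(A): the residues of elements of 𝒫(A) are closed under
-- addition, hence (by Bézout) under gcd, and gcd A = 1. If n = n_{c,A} had a representation with
-- N ≥ b summands, two of its b + 1 prefix sums would agree modulo b, and deleting the summands
-- between them would represent an element of the class of c, no larger than n, with fewer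
-- summands, contradicting the minimality of n and N. For A = {0, 1, b}, the element b - 1 is
-- n_{b-1,A} and can only be written with ones.

module Submission where

open import Defs
open import Data.Nat using (ℕ; zero; suc; _+_; _*_; _∸_; _≤_; _<_; z≤n; s≤s; NonZero; >-nonZero; pred; s≤s⁻¹; _≟_; _≤?_)
open import Data.Nat.Properties
open import Algebra.Properties.CommutativeSemigroup +-commutativeSemigroup using (xy∙z≈xz∙y)
open import Data.Nat.DivMod using (_%_; %-distribˡ-+; [m+kn]%n≡m%n; m≡m%n+[m/n]*n; _/_; m%n<n; m%n≤m; m<n⇒m%n≡m)
open import Data.Nat.GCD using (gcd; gcd-GCD; module Bézout)
open import Data.Nat.Induction using (<-rec)
open import Data.Nat.ListAction using (sum)
open import Data.Nat.ListAction.Properties using (sum-++)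
open import Data.Fin using (Fin; toℕ; fromℕ<)
open import Data.Fin.Properties using (pigeonhole; fromℕ<-injective; toℕ<n)
open import Data.List using (List; []; _∷_; _++_; length; take; drop)
open import Data.List.Properties using (length-++; take++drop≡id; length-drop)
open import Data.List.Relation.Unary.All as All using (All; []; _∷_)
open import Data.List.Relation.Unary.All.Properties using (++⁺; ++⁻)
open import Data.List.Relation.Unary.Any using (Any; any?; here; there)
open import Data.List.Membership.Propositional using (_∈_; find; lose)
open import Data.Product using (∃; _×_; _,_; proj₁; proj₂)
open import Data.Empty using (⊥-elim)
open import Function.Bundles using (_⇔_; mk⇔; module Equivalence)
open import Relation.Nullary using (¬_; Dec; yes; no)
open import Relation.Nullary.Decidable as Dec using (_×-dec_)
open import Relation.Unary using (Decidable)
open import Relation.Binary.PropositionalEquality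

Least : (ℕ → Set) → ℕ → Set
Least P m = P m × (∀ k → P k → m ≤ k)

least : {P : ℕ → Set} → Decidable P → ∀ {n} → P n → ∃ (Least P)
least {P} P? = <-rec (λ n → P n → ∃ (Least P)) search _
  where
  search : ∀ n → (∀ {k} → k < n → P k → ∃ (Least P)) → P n → ∃ (Least P)
  search n below pn with anyUpTo? P? n
  ... | yes (k , k<n , pk) = below k<n pk
  ... | no none            = n , pn , λ k pk → ≮⇒≥ λ k<n → none (k , k<n , pk)

module _ (b : ℕ) .{{_ : NonZero b}} where

  ModEq⇔%≡ : ∀ {m n} → ModEq b m n ⇔ m % b ≡ n % b
  ModEq⇔%≡ {m} {n} = mk⇔ to from
    where
    to : ModEq b m n → m % b ≡ n % b
    to (k , l , e) = begin
      m % b           ≡⟨ [m+kn]%n≡m%n m k b ⟨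
      (m + k * b) % b ≡⟨ cong (_% b) e ⟩
      (n + l * b) % b ≡⟨ [m+kn]%n≡m%n n l b ⟩
      n % b           ∎
      where open ≡-Reasoning
    from : m % b ≡ n % b → ModEq b m n
    from e = n / b , m / b , (begin
      m + n / b * b                 ≡⟨ cong (_+ n / b * b) (m≡m%n+[m/n]*n m b) ⟩
      m % b + m / b * b + n / b * b ≡⟨ cong (λ r → r + m / b * b + n / b * b) e ⟩
      n % b + m / b * b + n / b * b ≡⟨ xy∙z≈xz∙y (n % b) _ _ ⟩
      n % b + n / b * b + m / b * b ≡⟨ cong (_+ m / b * b) (m≡m%n+[m/n]*n n b) ⟨
      n + m / b * b                 ∎)
      where open ≡-Reasoning

  ModEq? : ∀ c m → Dec (ModEq b m c)
  ModEq? c m = Dec.map′ (Equivalence.from ModEq⇔%≡) (Equivalence.to ModEq⇔%≡) (m % b ≟ c % b)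

module _ {A : List ℕ} where

  InSumset-++ : ∀ {N M m n} → InSumset A N m → InSumset A M n → InSumset A (N + M) (m + n)
  InSumset-++ (xs , refl , xs∈A , refl) (ys , refl , ys∈A , refl) =
    xs ++ ys , length-++ xs , ++⁺ xs∈A ys∈A , sum-++ xs ys

  InP-0 : InP A 0
  InP-0 = 0 , [] , refl , [] , refl

  InSumset-∈ : ∀ {x} → x ∈ A → InSumset A 1 x
  InSumset-∈ {x} x∈A = x ∷ [] , refl , x∈A ∷ [] , +-identityʳ x

  InP-∈ : ∀ {x} → x ∈ A → InP A x
  InP-∈ x∈A = 1 , InSumset-∈ x∈A

  InP-+ : ∀ {m n} → InP A m → InP A n → InP A (m + n)
  InP-+ (N , m∈NA) (M , n∈MA) = N + M , InSumset-++ m∈NA n∈MA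

  InP-* : ∀ t {m} → InP A m → InP A (t * m)
  InP-* zero    m∈P = InP-0
  InP-* (suc t) m∈P = InP-+ m∈P (InP-* t m∈P)

  InSumset? : ∀ N n → Dec (InSumset A N n)
  InSumset? zero n = Dec.map′ empty (λ { ([] , _ , _ , s) → sym s }) (n ≟ 0)
    where
    empty : n ≡ 0 → InSumset A 0 n
    empty refl = [] , refl , [] , refl
  InSumset? (suc N) n =
    Dec.map′ cons uncons (any? (λ x → x ≤? n ×-dec InSumset? N (n ∸ x)) A)
    where
    cons : Any (λ x → x ≤ n × InSumset A N (n ∸ x)) A → InSumset A (suc N) n
    cons first with find first
    ... | x , x∈A , x≤n , xs , l , xs∈A , s =
      x ∷ xs , cong suc l , x∈A ∷ xs∈A , trans (cong (x +_) s) (m+[n∸m]≡n x≤n)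
    uncons : InSumset A (suc N) n → Any (λ x → x ≤ n × InSumset A N (n ∸ x)) A
    uncons (x ∷ xs , l , x∈A ∷ xs∈A , s) = lose x∈A
      ( subst (x ≤_) s (m≤m+n x (sum xs))
      , xs , suc-injective l , xs∈A , trans (sym (m+n∸m≡n x (sum xs))) (cong (_∸ x) s))

  drop-zeros : ∀ xs → All (_∈ A) xs → ∃ λ M → M ≤ sum xs × InSumset A M (sum xs)
  drop-zeros []            []          = 0 , z≤n , [] , refl , [] , refl
  drop-zeros (zero ∷ xs)   (_ ∷ xs∈A)  = drop-zeros xs xs∈A
  drop-zeros (suc x ∷ xs)  (x∈A ∷ xs∈A) with drop-zeros xs xs∈A
  ... | M , M≤ , ys , refl , ys∈A , s =
    suc M , s≤s (≤-trans M≤ (m≤n+m (sum xs) x)) , suc x ∷ ys , refl , x∈A ∷ ys∈A , cong (suc x +_) s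

  module _ (0∈A : 0 ∈ A) where

    pad-zeros : ∀ k {N n} → InSumset A N n → InSumset A (k + N) n
    pad-zeros zero    n∈NA = n∈NA
    pad-zeros (suc k) n∈NA with pad-zeros k n∈NA
    ... | xs , l , xs∈A , s = 0 ∷ xs , cong suc l , 0∈A ∷ xs∈A , s

    InP⇒InSumset : ∀ {n} → InP A n → InSumset A n n
    InP⇒InSumset (_ , xs , _ , xs∈A , refl) with drop-zeros xs xs∈A
    ... | M , M≤ , xs′ = subst (λ k → InSumset A k (sum xs)) (m∸n+n≡m M≤) (pad-zeros (sum xs ∸ M) xs′)

    InP? : Decidable (InP A)
    InP? n = Dec.map′ (n ,_) InP⇒InSumset (InSumset? n n)

module _ (A : List ℕ) (b : ℕ) .{{_ : NonZero b}} where

  ReachableResidue : ℕ → Set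
  ReachableResidue g = ∃ λ m → InP A m × m % b ≡ g % b

  reachable-+ : ∀ {g h} → ReachableResidue g → ReachableResidue h → ReachableResidue (g + h)
  reachable-+ {g} {h} (m , m∈P , m≡g) (n , n∈P , n≡h) = m + n , InP-+ m∈P n∈P , (begin
    (m + n) % b             ≡⟨ %-distribˡ-+ m n b ⟩
    (m % b + n % b) % b     ≡⟨ cong₂ (λ u v → (u + v) % b) m≡g n≡h ⟩
    (g % b + h % b) % b     ≡⟨ %-distribˡ-+ g h b ⟨
    (g + h) % b             ∎)
    where open ≡-Reasoning

  reachable-* : ∀ t {g} → ReachableResidue g → ReachableResidue (t * g)
  reachable-* zero    _  = 0 , InP-0 , refl
  reachable-* (suc t) rg = reachable-+ rg (reachable-* t rg)

  -- Subtracting h modulo b is adding (b - 1) h.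
  reachable-∸ : ∀ {g h} → ReachableResidue (g + h) → ReachableResidue h → ReachableResidue g
  reachable-∸ {g} {h} rg+h rh with reachable-+ rg+h (reachable-* (pred b) rh)
  ... | m , m∈P , m≡ = m , m∈P , trans m≡ (begin
    (g + h + pred b * h) % b   ≡⟨ cong (_% b) (+-assoc g h (pred b * h)) ⟩
    (g + suc (pred b) * h) % b ≡⟨ cong (λ k → (g + k * h) % b) (suc-pred b) ⟩
    (g + b * h) % b            ≡⟨ cong (λ k → (g + k) % b) (*-comm b h) ⟩
    (g + h * b) % b            ≡⟨ [m+kn]%n≡m%n g h b ⟩
    g % b                      ∎)
    where open ≡-Reasoning

  reachable-gcd : ∀ {x y} → ReachableResidue x → ReachableResidue y → ReachableResidue (gcd x y)
  reachable-gcd {x} {y} rx ry with Bézout.identity (gcd-GCD x y)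
  ... | Bézout.+- u v eq = reachable-∸ (subst ReachableResidue (sym eq) (reachable-* u rx)) (reachable-* v ry)
  ... | Bézout.-+ u v eq = reachable-∸ (subst ReachableResidue (sym eq) (reachable-* v ry)) (reachable-* u rx)

  reachable-gcdList : ∀ {L} → All ReachableResidue L → ReachableResidue (gcdList L)
  reachable-gcdList []         = 0 , InP-0 , refl
  reachable-gcdList (rx ∷ rxs) = reachable-gcd rx (reachable-gcdList rxs)

  all-residues-reachable : gcdList A ≡ 1 → ∀ a → ReachableResidue a
  all-residues-reachable gcd≡1 a = subst ReachableResidue (*-identityʳ a) (reachable-* a reachable-1)
    where
    reachable-1 : ReachableResidue 1
    reachable-1 = subst ReachableResidue gcd≡1 (reachable-gcdList (All.tabulate λ {x} x∈A → x , InP-∈ x∈A , refl))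

take-+ : ∀ {X : Set} i d (xs : List X) → take (i + d) xs ≡ take i xs ++ take d (drop i xs)
take-+ zero    d       xs       = refl
take-+ (suc i) zero    []       = refl
take-+ (suc i) (suc d) []       = refl
take-+ (suc i) d       (x ∷ xs) = cong (x ∷_) (take-+ i d xs)

0<length-take-suc : ∀ {X : Set} d (xs : List X) → 0 < length xs → 0 < length (take (suc d) xs)
0<length-take-suc d (x ∷ xs) _ = s≤s z≤n

module _ (b : ℕ) .{{_ : NonZero b}} where

  [m+n]%b≡m%b⇒[m+[n+k]]%b≡[m+k]%b : ∀ m n k → (m + n) % b ≡ m % b → (m + (n + k)) % b ≡ (m + k) % b
  [m+n]%b≡m%b⇒[m+[n+k]]%b≡[m+k]%b m n k e = begin
    (m + (n + k)) % b           ≡⟨ cong (_% b) (+-assoc m n k) ⟨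
    (m + n + k) % b             ≡⟨ %-distribˡ-+ (m + n) k b ⟩
    ((m + n) % b + k % b) % b   ≡⟨ cong (λ r → (r + k % b) % b) e ⟩
    (m % b + k % b) % b         ≡⟨ %-distribˡ-+ m k b ⟨
    (m + k) % b                 ∎
    where open ≡-Reasoning

  -- By pigeonhole two of the b + 1 prefix sums of xs agree modulo b; q is the block between them.
  removable-block : ∀ xs → b ≤ length xs → ∃ λ p → ∃ λ q → ∃ λ r →
    xs ≡ p ++ q ++ r × 0 < length q × (sum p + sum q) % b ≡ sum p % b
  removable-block xs b≤ with pigeonhole (s≤s b≤) prefix-residue
    where
    prefix-residue : Fin (suc (length xs)) → Fin b
    prefix-residue k = fromℕ< (m%n<n (sum (take (toℕ k) xs)) b)
  ... | i , j , i<j , same with m≤n⇒∃[o]m+o≡n i<j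
  ... | d , I+1+d≡J =
    take I xs , take (suc d) (drop I xs) , drop (suc d) (drop I xs) ,
    sym (trans (cong (take I xs ++_) (take++drop≡id (suc d) (drop I xs))) (take++drop≡id I xs)) ,
    0<length-take-suc d (drop I xs) 0<length-drop ,
    (begin
      (sum (take I xs) + sum (take (suc d) (drop I xs))) % b ≡⟨ cong (_% b) (sum-++ (take I xs) _) ⟨
      sum (take I xs ++ take (suc d) (drop I xs)) % b       ≡⟨ cong (λ ys → sum ys % b) (take-+ I (suc d) xs) ⟨
      sum (take (I + suc d) xs) % b                         ≡⟨ cong (λ k → sum (take k xs) % b) (+-suc I d) ⟩
      sum (take (suc I + d) xs) % b                         ≡⟨ cong (λ k → sum (take k xs) % b) I+1+d≡J ⟩
      sum (take (toℕ j) xs) % b                             ≡⟨ fromℕ<-injective _ _ _ _ same ⟨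
      sum (take I xs) % b                                   ∎)
    where
    open ≡-Reasoning
    I : ℕ
    I = toℕ i
    I<length : I < length xs
    I<length = ≤-trans (m≤m+n (suc I) d) (subst (_≤ length xs) (sym I+1+d≡J) (s≤s⁻¹ (toℕ<n j)))
    0<length-drop : 0 < length (drop I xs)
    0<length-drop = subst (0 <_) (sym (length-drop I xs)) (m<n⇒0<n∸m I<length)

  shorten : ∀ {A N n} → InSumset A N n → b ≤ N →
    ∃ λ M → ∃ λ m → InSumset A M m × M < N × m ≤ n × m % b ≡ n % b
  shorten (xs , refl , xs∈A , refl) b≤ with removable-block xs b≤
  ... | p , q , r , refl , 0<q , neutral with ++⁻ p xs∈A
  ... | p∈A , qr∈A with ++⁻ q qr∈A
  ... | _ , r∈A =
    length (p ++ r) , sum (p ++ r) , (p ++ r , refl , ++⁺ p∈A r∈A , refl) ,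
    subst₂ _<_ (sym (length-++ p)) (sym lengths) (+-monoʳ-< (length p) (m<n+m (length r) 0<q)) ,
    subst₂ _≤_ (sym (sum-++ p r)) (sym sums) (+-monoʳ-≤ (sum p) (m≤n+m (sum r) (sum q))) ,
    (begin
      sum (p ++ r) % b           ≡⟨ cong (_% b) (sum-++ p r) ⟩
      (sum p + sum r) % b        ≡⟨ [m+n]%b≡m%b⇒[m+[n+k]]%b≡[m+k]%b (sum p) (sum q) (sum r) neutral ⟨
      (sum p + (sum q + sum r)) % b ≡⟨ cong (_% b) sums ⟨
      sum (p ++ q ++ r) % b      ∎)
    where
    open ≡-Reasoning
    lengths : length (p ++ q ++ r) ≡ length p + (length q + length r)
    lengths = trans (length-++ p) (cong (length p +_) (length-++ q))
    sums : sum (p ++ q ++ r) ≡ sum p + (sum q + sum r)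
    sums = trans (sum-++ p (q ++ r)) (cong (sum p +_) (sum-++ q r))

IsNc-exists : ∀ b .{{_ : NonZero b}} {A} → 0 ∈ A → gcdList A ≡ 1 → ∀ c → ∃ (IsNc A b c)
IsNc-exists b {A} 0∈A gcd≡1 c with all-residues-reachable A b gcd≡1 c
... | m , m∈P , m≡c with least (λ k → ModEq? b c k ×-dec InP? 0∈A k) (Equivalence.from (ModEq⇔%≡ b) m≡c , m∈P)
... | n , (n≡c , n∈P) , n-least = n , n≡c , n∈P , λ k k≡c k∈P → n-least k (k≡c , k∈P)

IsNN-exists : ∀ {A n} → InP A n → ∃ (IsNN A n)
IsNN-exists {n = n} (_ , n∈NA) = least (λ N → InSumset? N n) n∈NA

IsNN<modulus : ∀ b .{{_ : NonZero b}} {A c n N} → IsNc A b c n → IsNN A n N → N < b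
IsNN<modulus b {A} {c} {n} {N} (n≡c , _ , n-least) (n∈NA , N-least) = ≰⇒> b≰N
  where
  b≰N : ¬ b ≤ N
  b≰N b≤N with shorten b n∈NA b≤N
  ... | M , m , m∈MA , M<N , m≤n , m≡n = <⇒≱ M<N (N-least M (subst (InSumset A M) m≡n′ m∈MA))
    where
    m≡c : ModEq b m c
    m≡c = Equivalence.from (ModEq⇔%≡ b) (trans m≡n (Equivalence.to (ModEq⇔%≡ b) n≡c))
    m≡n′ : m ≡ n
    m≡n′ = ≤-antisym m≤n (n-least m m≡c (M , m∈MA))

minimal-representation : ∀ {A b} → Admissible A b → ∀ c →
  ∃ λ n → ∃ λ N → IsNc A b c n × IsNN A n N × N < b
minimal-representation {b = b} adm c =
  let n , n-isNc = IsNc-exists b zero∈A gcd≡1 c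
      N , N-isNN = IsNN-exists (proj₁ (proj₂ n-isNc))
  in  n , N , n-isNc , N-isNN , IsNN<modulus b n-isNc N-isNN
  where
  open Admissible adm
  instance
    b≢0 : NonZero b
    b≢0 = >-nonZero b≥1

IsNc-self : ∀ {A b c} .{{_ : NonZero b}} → c < b → InP A c → IsNc A b c c
IsNc-self {A} {b} {c} c<b c∈P = (0 , 0 , refl) , c∈P , c-least
  where
  c-least : ∀ m → ModEq b m c → InP A m → c ≤ m
  c-least m m≡c _ = subst (_≤ m) (trans (Equivalence.to (ModEq⇔%≡ b) m≡c) (m<n⇒m%n≡m c<b)) (m%n≤m m b)

ones : ∀ {A} → 1 ∈ A → ∀ k → InSumset A k k
ones 1∈A zero    = [] , refl , [] , refl
ones 1∈A (suc k) = InSumset-++ (InSumset-∈ 1∈A) (ones 1∈A k)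

sum≤length : ∀ b xs → All (_∈ 0 ∷ 1 ∷ b ∷ []) xs → sum xs < b → sum xs ≤ length xs
sum≤length b []       []                                  _     = z≤n
sum≤length b (x ∷ xs) (here refl ∷ xs∈A)                  sum<b = m≤n⇒m≤1+n (sum≤length b xs xs∈A sum<b)
sum≤length b (x ∷ xs) (there (here refl) ∷ xs∈A)          sum<b = s≤s (sum≤length b xs xs∈A (≤-trans (n≤1+n _) sum<b))
sum≤length b (x ∷ xs) (there (there (here refl)) ∷ _)     sum<b = ⊥-elim (<⇒≱ sum<b (m≤m+n b (sum xs)))

IsNN-0-1-b : ∀ {b n} → n < b → IsNN (0 ∷ 1 ∷ b ∷ []) n n
IsNN-0-1-b {b} {n} n<b = ones (there (here refl)) n , n-least
  where
  n-least : ∀ M → InSumset (0 ∷ 1 ∷ b ∷ []) M n → n ≤ M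
  n-least M (xs , refl , xs∈A , refl) = sum≤length b xs xs∈A n<b

mainTheorem11 : ((A : List ℕ) (b : ℕ) → Admissible A b →
    ∀ a → a < b → ∃ λ n → ∃ λ N → IsNc A b a n × IsNN A n N × N ≤ b ∸ 1)
    × ((b : ℕ) → Admissible (0 ∷ 1 ∷ b ∷ []) b →
    ∃ λ n → IsNc (0 ∷ 1 ∷ b ∷ []) b (b ∸ 1) n × IsNN (0 ∷ 1 ∷ b ∷ []) n (b ∸ 1))
mainTheorem11 = residue-bound , extremal-case
  where
  residue-bound : (A : List ℕ) (b : ℕ) → Admissible A b →
    ∀ a → a < b → ∃ λ n → ∃ λ N → IsNc A b a n × IsNN A n N × N ≤ b ∸ 1
  residue-bound A b adm a _ =
    let n , N , n-isNc , N-isNN , N<b = minimal-representation adm a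
    in  n , N , n-isNc , N-isNN , <⇒≤pred N<b

  extremal-case : (b : ℕ) → Admissible (0 ∷ 1 ∷ b ∷ []) b →
    ∃ λ n → IsNc (0 ∷ 1 ∷ b ∷ []) b (b ∸ 1) n × IsNN (0 ∷ 1 ∷ b ∷ []) n (b ∸ 1)
  extremal-case zero    adm with () ← Admissible.b≥1 adm
  extremal-case (suc b) _   = b , IsNc-self ≤-refl (b , ones (there (here refl)) b) , IsNN-0-1-b ≤-refl
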